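{- Let $S\subseteq\mathbb{I}_n^m$ be colored, i.e. $S\subseteq\xi^i[n]$ for some $i\in\{0,\dots,m-1\}$. Then there exists a positive integer $N$ such that $S$ (viewed as a subset of $\mathbb{I}_N^m$) is an admissible pinnacle set for $\mathbb{Z}_m\wr S_N$.
   Context: For positive integers $m,N$, $[N]=\{1,\dots,N\}$, $\xi=e^{2\pi i/m}$; for $0\le a\le m-1$, $x\in[N]$, $\xi^a(x)$ denotes $\xi^a\cdot x$, $\xi^a[N]=\{\xi^a(1),\dots,\xi^a(N)\}$ and $\mathbb{I}_N^m=\bigcup_{a=0}^{m-1}\xi^a[N]$, totally ordered by $\xi^a(x)\prec\xi^b(y)$ iff $a>b$, or $a=b$ and $x>y$. $\mathbb{Z}_m\wr S_N$ is the group of bijections $w$ of $\mathbb{I}_N^m$ with $w(\xi^i x)=\xi^i w(x)$ for $x\in[N]$ and all $i$, written $w(N)\cdots w(1)$. $\operatorname{Pin}(w)=\{w(i):2\le i\le N-1,\ w(i+1)\prec w(i)\succ w(i-1)\}$. $P\subseteq\mathbb{I}_N^m$ is an admissible pinnacle set for $\mathbb{Z}_m\wr S_N$ if $P=\operatorname{Pin}(w)$ for some $w\in\mathbb{Z}_m\wr S_N$. -}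

module Defs where

open import Data.Nat using (ℕ; zero; suc; _+_; _<_; _≤_)
open import Data.Fin using (Fin; toℕ; fromℕ<)
open import Data.Fin.Permutation using (Permutation′; _⟨$⟩ʳ_)
open import Data.Product using (Σ; _×_; _,_; proj₁; proj₂)
open import Data.Sum using (_⊎_)
open import Relation.Binary.PropositionalEquality using (_≡_)

-- An element ξ^a(x) of 𝕀_N^m is encoded as a pair (a , x) with
-- a : Fin m the colour exponent and x : Fin N encoding the integer toℕ x + 1 ∈ [N].
Elem : ℕ → ℕ → Set
Elem m N = Fin m × Fin N

_≺_ : ∀ {m N} → Elem m N → Elem m N → Set
(a , x) ≺ (b , y) = (toℕ b < toℕ a) ⊎ ((a ≡ b) × (toℕ y < toℕ x))

-- An element w of ℤ_m ≀ S_N is determined by its values w(1),…,w(N):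
-- w(j) = ξ^{c j}(π j), with π a permutation of [N] and c : [N] → colours.
-- (Equivariance w(ξ^i x) = ξ^i w(x) then determines w on all of 𝕀_N^m.)
record Wreath (m N : ℕ) : Set where
  constructor wreath
  field
    perm   : Permutation′ N
    colour : Fin N → Fin m

-- w(j) for j : Fin N (meaning position toℕ j + 1).
apply : ∀ {m N} → Wreath m N → Fin N → Elem m N
apply (wreath π c) j = (c j , π ⟨$⟩ʳ j)

-- e ∈ Pin(w): there is a position i (2 ≤ i ≤ N-1; here 0-indexed as j+1
-- with j + 2 < N) such that w(i+1) ≺ w(i) ≻ w(i-1) and w(i) = e.
InPin : ∀ {m N} → Wreath m N → Elem m N → Set
InPin {m} {N} w e =
  Σ ℕ λ j → Σ (suc (suc j) < N) λ p →
    let lo  = fromℕ< {j} {N} (Data.Nat.Properties.<-trans (Data.Nat.Properties.n<1+n j)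
                        (Data.Nat.Properties.<-trans (Data.Nat.Properties.n<1+n (suc j)) p))
        mid = fromℕ< {suc j} {N} (Data.Nat.Properties.<-trans (Data.Nat.Properties.n<1+n (suc j)) p)
        hi  = fromℕ< {suc (suc j)} {N} p
    in (apply w mid ≡ e) × (apply w hi ≺ apply w mid) × (apply w lo ≺ apply w mid)
  where import Data.Nat.Properties

{-# OPTIONS --safe #-}
-- Give every letter the colour i and take N = 2n + 1. Within one colour ≺ reverses the order of
-- [N], so the pinnacles of such a w are the valleys of its value sequence (values counted from 0).
-- List the values n + j with j ∉ T in increasing order, then 2n, then n - 1, n - 2, …, 0 with each
-- j ∈ T immediately followed by n + j. The increasing prefix and the peak 2n contain no valley; in
-- the descending part each j ∈ T lies between two larger values, while each j ∉ T is followed by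
-- the smaller j - 1 or ends the sequence.
module Submission where

open import Defs
open import Data.Nat using (ℕ; zero; suc; _+_; _∸_; _<_; _≤_; z≤n; s≤s)
open import Data.Nat.Properties
open import Data.Fin using (Fin; toℕ; fromℕ<; punchOut)
open import Data.Fin.Properties using (toℕ-fromℕ<; toℕ-injective; toℕ<n; any?; injective⇒≤; punchOut-injective)
  renaming (_≟_ to _≟ᶠ_)
open import Data.Fin.Permutation using (Permutation′; permutation; _⟨$⟩ʳ_)
open import Data.Fin.Subset using (Subset; _∈_)
open import Data.Fin.Subset.Properties using (_∈?_)
open import Data.List using (List; []; _∷_; _++_; _∷ʳ_; [_]; length; lookup)
open import Data.List.Properties using (length-++)
import Data.List.Membership.Propositional as List
open import Data.List.Membership.Propositional.Properties using (∈-lookup; ∈-++⁺ˡ; ∈-++⁺ʳ)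
open import Data.List.Relation.Unary.All as All using (All; []; _∷_)
import Data.List.Relation.Unary.All.Properties as All
open import Data.List.Relation.Unary.AllPairs using (AllPairs; []; _∷_)
import Data.List.Relation.Unary.AllPairs.Properties as AllPairs
open import Data.List.Relation.Unary.Any using (here; there; index)
open import Data.List.Relation.Unary.Any.Properties using (lookup-index)
open import Data.Product using (Σ; _×_; _,_)
open import Data.Product.Function.NonDependent.Propositional using (_×-⇔_)
open import Data.Sum using (inj₁; inj₂)
open import Function.Bundles using (_⇔_; mk⇔; Equivalence)
open import Function.Construct.Composition using (_⇔-∘_)
open import Function.Construct.Identity using (⇔-id)
open import Function.Definitions using (Injective; StrictlySurjective)
open import Relation.Nullary using (yes; no; ¬_; contradiction)
open import Relation.Nullary.Decidable using (_×-dec_)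
open import Level using (0ℓ)
open import Relation.Unary using (Pred; Decidable)
open import Relation.Binary.PropositionalEquality using (_≡_; _≢_; refl; sym; trans; cong; subst; subst₂)
open Relation.Binary.PropositionalEquality.≡-Reasoning

data Valley : List ℕ → ℕ → Set where
  here  : ∀ {a v b xs} → v < a → v < b → Valley (a ∷ v ∷ b ∷ xs) v
  there : ∀ {a xs v} → Valley xs v → Valley (a ∷ xs) v

valley-++⁺ʳ : ∀ {ys v} xs → Valley ys v → Valley (xs ++ ys) v
valley-++⁺ʳ []       p = p
valley-++⁺ʳ (_ ∷ xs) p = there (valley-++⁺ʳ xs p)

valley-tail-after-rise : ∀ {x y zs v} → x < y → Valley (x ∷ y ∷ zs) v → Valley (y ∷ zs) v
valley-tail-after-rise x<y (here y<x _) = contradiction x<y (<⇒≯ y<x)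
valley-tail-after-rise _   (there p)    = p

valley-tail-before-fall : ∀ {a x y zs v} → y < x → Valley (a ∷ x ∷ y ∷ zs) v → Valley (x ∷ y ∷ zs) v
valley-tail-before-fall y<x (here _ x<y) = contradiction y<x (<⇒≯ x<y)
valley-tail-before-fall _   (there p)    = p

valley-++-ascending : ∀ {xs a ys v} → AllPairs _<_ xs → All (_< a) xs →
                      Valley (xs ++ a ∷ ys) v → Valley (a ∷ ys) v
valley-++-ascending []                            []          p = p
valley-++-ascending {_ ∷ []}    _                  (x<a ∷ [])  p = valley-tail-after-rise x<a p
valley-++-ascending {_ ∷ _ ∷ _} ((x<y ∷ _) ∷ asc) (_ ∷ bound) p =
  valley-++-ascending asc bound (valley-tail-after-rise x<y p)

-- Valley in index form, its components ordered as in InPin; fromℕ< ignores its (irrelevant)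
-- bound proof, so these positions agree definitionally with those of InPin.
ValleyAt : (xs : List ℕ) (j : ℕ) → suc (suc j) < length xs → ℕ → Set
ValleyAt xs j p v =
  (lookup xs (fromℕ< (<-trans (n<1+n _) p)) ≡ v) ×
  (v < lookup xs (fromℕ< p)) ×
  (v < lookup xs (fromℕ< (<-trans (n<1+n _) (<-trans (n<1+n _) p))))

valley⇒valleyAt : ∀ {xs v} → Valley xs v → Σ ℕ λ j → Σ (suc (suc j) < length xs) λ p → ValleyAt xs j p v
valley⇒valleyAt (here v<a v<b) = 0 , s≤s (s≤s (s≤s z≤n)) , refl , v<b , v<a
valley⇒valleyAt (there p) with j , j<len , at ← valley⇒valleyAt p = suc j , s≤s j<len , at

valleyAt⇒valley : ∀ {v} xs j p → ValleyAt xs j p v → Valley xs v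
valleyAt⇒valley (_ ∷ _ ∷ _ ∷ _) zero    _               (refl , v<c , v<a) = here v<a v<c
valleyAt⇒valley (_ ∷ _ ∷ [])    zero    (s≤s (s≤s ()))  _
valleyAt⇒valley (_ ∷ xs)        (suc j) (s≤s p)         at = there (valleyAt⇒valley xs j p at)

injective⇒strictlySurjective : ∀ {n} {f : Fin n → Fin n} →
                               Injective _≡_ _≡_ f → StrictlySurjective _≡_ f
injective⇒strictlySurjective {zero}  _     ()
injective⇒strictlySurjective {suc n} {f} f-inj y with any? (λ x → f x ≟ᶠ y)
... | yes preimage = preimage
... | no  missed   = contradiction (injective⇒≤ avoid-y-injective) 1+n≰n
  where
  fx≢y : ∀ x → y ≢ f x
  fx≢y x y≡fx = missed (x , sym y≡fx)
  avoid-y : Fin (suc n) → Fin n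
  avoid-y x = punchOut (fx≢y x)
  avoid-y-injective : Injective _≡_ _≡_ avoid-y
  avoid-y-injective eq = f-inj (punchOut-injective (fx≢y _) (fx≢y _) eq)

module ListPermutation (L : List ℕ) (bounded : All (_< length L) L)
                       (complete : ∀ {v} → v < length L → v List.∈ L) where

  read : Fin (length L) → Fin (length L)
  read j = fromℕ< (All.lookup bounded (∈-lookup j))

  position : Fin (length L) → Fin (length L)
  position v = index (complete (toℕ<n v))

  toℕ-read : ∀ j → toℕ (read j) ≡ lookup L j
  toℕ-read j = toℕ-fromℕ< _

  read∘position : ∀ v → read (position v) ≡ v
  read∘position v = toℕ-injective (trans (toℕ-read _) (sym (lookup-index (complete (toℕ<n v)))))

  position-injective : Injective _≡_ _≡_ position
  position-injective {u} {v} eq = trans (sym (read∘position u)) (trans (cong read eq) (read∘position v))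

  position∘read : ∀ j → position (read j) ≡ j
  position∘read j with v , refl ← injective⇒strictlySurjective position-injective j =
    cong position (read∘position v)

  listPermutation : Permutation′ (length L)
  listPermutation = permutation read position read∘position position∘read

monochrome : ∀ {m N} → Permutation′ N → Fin m → Wreath m N
monochrome π c = wreath π (λ _ → c)

≺-monochrome : ∀ {m N} {c : Fin m} {u v : Fin N} → _≺_ {m} {N} (c , u) (c , v) ⇔ toℕ v < toℕ u
≺-monochrome = mk⇔ (λ { (inj₁ c<c) → contradiction c<c (n≮n _) ; (inj₂ (_ , v<u)) → v<u })
                   (λ v<u → inj₂ (refl , v<u))

module _ {m} (L : List ℕ) (π : Permutation′ (length L))
         (π-reads-L : ∀ j → toℕ (π ⟨$⟩ʳ j) ≡ lookup L j) (c : Fin m) where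

  private
    ≺⇔lookup-> : ∀ {i k} → apply (monochrome π c) k ≺ apply (monochrome π c) i ⇔ lookup L i < lookup L k
    ≺⇔lookup-> {i} {k} = mk⇔ (subst₂ _<_ (π-reads-L i) (π-reads-L k))
                             (subst₂ _<_ (sym (π-reads-L i)) (sym (π-reads-L k)))
                         ⇔-∘ ≺-monochrome

  pinnacle⇔valley : ∀ a x → InPin (monochrome π c) (a , x) ⇔ ((a ≡ c) × Valley L (toℕ x))
  pinnacle⇔valley a x = mk⇔ to from
    where
    to : InPin (monochrome π c) (a , x) → (a ≡ c) × Valley L (toℕ x)
    to (j , p , refl , hi≺mid , lo≺mid) = refl , subst (Valley L) (sym (π-reads-L _))
      (valleyAt⇒valley L j p (refl , Equivalence.to ≺⇔lookup-> hi≺mid , Equivalence.to ≺⇔lookup-> lo≺mid))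
    from : (a ≡ c) × Valley L (toℕ x) → InPin (monochrome π c) (a , x)
    from (refl , valley) with j , p , mid≡x , x<hi , x<lo ← valley⇒valleyAt valley =
      j , p , cong (c ,_) (toℕ-injective (trans (π-reads-L _) mid≡x)) ,
      Equivalence.from ≺⇔lookup-> (subst (_< _) (sym mid≡x) x<hi) ,
      Equivalence.from ≺⇔lookup-> (subst (_< _) (sym mid≡x) x<lo)

+-suc-cong : ∀ {a d m} → a + d ≡ m + m → a + suc d ≡ m + suc m
+-suc-cong {a} {d} {m} eq = trans (+-suc a d) (trans (cong suc eq) (sym (+-suc m m)))

module Construction {ℓ} {P : Pred ℕ ℓ} (P? : Decidable P) (n : ℕ) (P-bounded : ∀ {v} → P v → v < n) where

  ascent : ℕ → List ℕ
  ascent zero = []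
  ascent (suc m) with P? m
  ... | yes _ = ascent m
  ... | no  _ = ascent m ∷ʳ (n + m)

  withPartner : ℕ → List ℕ → List ℕ
  withPartner m xs with P? m
  ... | yes _ = n + m ∷ xs
  ... | no  _ = xs

  descent : ℕ → List ℕ
  descent zero    = []
  descent (suc m) = m ∷ withPartner m (descent m)

  word : List ℕ
  word = ascent n ++ n + n ∷ descent n

  length-ascent+descent : ∀ m → length (ascent m) + length (descent m) ≡ m + m
  length-ascent+descent zero = refl
  length-ascent+descent (suc m) with P? m
  ... | yes _ = begin
    A + suc (suc D)  ≡⟨ +-suc A (suc D) ⟩
    suc (A + suc D)  ≡⟨ cong suc (+-suc-cong (length-ascent+descent m)) ⟩
    suc m + suc m    ∎
    where A = length (ascent m); D = length (descent m)
  ... | no _ = begin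
    length (ascent m ++ [ n + m ]) + suc D  ≡⟨ cong (_+ suc D) (trans (length-++ (ascent m)) (+-comm A 1)) ⟩
    suc (A + suc D)                         ≡⟨ cong suc (+-suc-cong (length-ascent+descent m)) ⟩
    suc m + suc m                           ∎
    where A = length (ascent m); D = length (descent m)

  length-word : length word ≡ suc (n + n)
  length-word = begin
    length (ascent n ++ n + n ∷ descent n)        ≡⟨ length-++ (ascent n) ⟩
    length (ascent n) + suc (length (descent n))  ≡⟨ +-suc _ _ ⟩
    suc (length (ascent n) + length (descent n))  ≡⟨ cong suc (length-ascent+descent n) ⟩
    suc (n + n)                                   ∎

  <n+m⇒<n+1+m : ∀ {v m} → v < n + m → v < n + suc m
  <n+m⇒<n+1+m {m = m} v<n+m = <-≤-trans v<n+m (+-monoʳ-≤ n (n≤1+n m))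

  ascent-bounded : ∀ m → All (_< n + m) (ascent m)
  ascent-bounded zero = []
  ascent-bounded (suc m) with P? m
  ... | yes _ = All.map <n+m⇒<n+1+m (ascent-bounded m)
  ... | no  _ = All.++⁺ (All.map <n+m⇒<n+1+m (ascent-bounded m)) (+-monoʳ-< n (n<1+n m) ∷ [])

  ascent-increasing : ∀ m → AllPairs _<_ (ascent m)
  ascent-increasing zero = []
  ascent-increasing (suc m) with P? m
  ... | yes _ = ascent-increasing m
  ... | no  _ = AllPairs.++⁺ (ascent-increasing m) ([] ∷ []) (All.map (_∷ []) (ascent-bounded m))

  withPartner-bounded : ∀ {m xs} → All (_< n + suc m) xs → All (_< n + suc m) (withPartner m xs)
  withPartner-bounded {m} bound with P? m
  ... | yes _ = +-monoʳ-< n (n<1+n m) ∷ bound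
  ... | no  _ = bound

  descent-bounded : ∀ m → All (_< n + m) (descent m)
  descent-bounded zero = []
  descent-bounded (suc m) =
    m≤n+m (suc m) n ∷ withPartner-bounded (All.map <n+m⇒<n+1+m (descent-bounded m))

  word-bounded : All (_< length word) word
  word-bounded = subst (λ N → All (_< N) word) (sym length-word)
    (All.++⁺ (All.map m<n⇒m<1+n (ascent-bounded n))
             (n<1+n (n + n) ∷ All.map m<n⇒m<1+n (descent-bounded n)))

  n<length-word : n < length word
  n<length-word = subst (n <_) (sym length-word) (s≤s (m≤m+n n n))

  ∈-withPartner : ∀ {m x xs} → x List.∈ xs → x List.∈ withPartner m xs
  ∈-withPartner {m} x∈xs with P? m
  ... | yes _ = there x∈xs
  ... | no  _ = x∈xs

  ∈-descent : ∀ {j m} → j < m → j List.∈ descent m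
  ∈-descent {m = suc m} j<1+m with m<1+n⇒m<n∨m≡n j<1+m
  ... | inj₁ j<m  = there (∈-withPartner (∈-descent j<m))
  ... | inj₂ refl = here refl

  partner-∈-descent : ∀ {j m} → j < m → P j → n + j List.∈ descent m
  partner-∈-descent {m = suc m} j<1+m Pj with m<1+n⇒m<n∨m≡n j<1+m
  ... | inj₁ j<m  = there (∈-withPartner (partner-∈-descent j<m Pj))
  ... | inj₂ refl with P? m
  ...   | yes _   = there (here refl)
  ...   | no ¬Pj  = contradiction Pj ¬Pj

  ∈-ascent : ∀ {j m} → j < m → ¬ P j → n + j List.∈ ascent m
  ∈-ascent {m = suc m} j<1+m ¬Pj with m<1+n⇒m<n∨m≡n j<1+m | P? m
  ... | inj₁ j<m  | yes _ = ∈-ascent j<m ¬Pj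
  ... | inj₁ j<m  | no  _ = ∈-++⁺ˡ (∈-ascent j<m ¬Pj)
  ... | inj₂ refl | yes Pj = contradiction Pj ¬Pj
  ... | inj₂ refl | no  _  = ∈-++⁺ʳ (ascent m) (here refl)

  word-complete : ∀ {v} → v < length word → v List.∈ word
  word-complete {v} v<N with v <? n
  ... | yes v<n = ∈-++⁺ʳ (ascent n) (there (∈-descent v<n))
  ... | no  v≮n with v ∸ n | m+[n∸m]≡n (≮⇒≥ v≮n)
  ...   | j | refl = high-∈-word (+-cancelˡ-≤ n j n (m<1+n⇒m≤n (subst (n + j <_) length-word v<N)))
    where
    high-∈-word : ∀ {j} → j ≤ n → n + j List.∈ word
    high-∈-word {j} j≤n with m≤n⇒m<n∨m≡n j≤n | P? j
    ... | inj₁ j<n  | yes Pj  = ∈-++⁺ʳ (ascent n) (there (partner-∈-descent j<n Pj))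
    ... | inj₁ j<n  | no  ¬Pj = ∈-++⁺ˡ (∈-ascent j<n ¬Pj)
    ... | inj₂ refl | _       = ∈-++⁺ʳ (ascent n) (here refl)

  valley-tail-before-descent : ∀ {a m v} → Valley (a ∷ m ∷ descent m) v → Valley (m ∷ descent m) v
  valley-tail-before-descent {m = zero}  (there p) = p
  valley-tail-before-descent {m = suc m} p         = valley-tail-before-fall (n<1+n m) p

  valley-descent⁻ : ∀ {a m v} → m ≤ a → Valley (a ∷ descent m) v → P v
  valley-descent⁻ {m = zero}  _ (there ())
  valley-descent⁻ {m = suc m} _ p with P? m
  ... | yes Pm = with-partner Pm p
    where
    with-partner : ∀ {a v} → P m → Valley (a ∷ m ∷ n + m ∷ descent m) v → P v
    with-partner Pm (here _ _) = Pm
    with-partner Pm (there p)  =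
      valley-descent⁻ (m≤n+m m n) (valley-tail-after-rise (m<n+m m (m<n⇒0<n (P-bounded Pm))) p)
  ... | no  _  = valley-descent⁻ ≤-refl (valley-tail-before-descent p)

  valley-descent⁺ : ∀ {a j m} → j < m → m ≤ a → P j → Valley (a ∷ descent m) j
  valley-descent⁺ {m = suc m} j<1+m 1+m≤a Pj with m<1+n⇒m<n∨m≡n j<1+m | P? m
  ... | inj₁ j<m  | yes _  = there (there (valley-descent⁺ j<m (m≤n+m m n) Pj))
  ... | inj₁ j<m  | no  _  = there (valley-descent⁺ j<m ≤-refl Pj)
  ... | inj₂ refl | yes _  = here 1+m≤a (m<n+m m (m<n⇒0<n (P-bounded Pj)))
  ... | inj₂ refl | no ¬Pj = contradiction Pj ¬Pj

  valley-word : ∀ {v} → Valley word v ⇔ P v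
  valley-word = mk⇔
    (λ p → valley-descent⁻ (m≤m+n n n) (valley-++-ascending (ascent-increasing n) (ascent-bounded n) p))
    (λ Pv → valley-++⁺ʳ (ascent n) (valley-descent⁺ (P-bounded Pv) (m≤m+n n n) Pv))

mainTheorem9 : (m n : ℕ) → 1 ≤ m → 1 ≤ n → (i : Fin m) → (T : Subset n) →
    Σ ℕ λ N → (1 ≤ N) × ((k : Fin n) → k ∈ T → toℕ k < N) ×
      Σ (Wreath m N) λ w →
        (a : Fin m) → (x : Fin N) →
          InPin w (a , x) ⇔ ((a ≡ i) × Σ (Fin n) λ k → (toℕ k ≡ toℕ x) × (k ∈ T))
mainTheorem9 m n _ _ i T =
  length word , m<n⇒0<n n<length-word , (λ k _ → <-trans (toℕ<n k) n<length-word) ,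
  monochrome listPermutation i ,
  λ a x → (⇔-id _ ×-⇔ valley-word) ⇔-∘ pinnacle⇔valley word listPermutation toℕ-read i a x
  where
  InT : Pred ℕ 0ℓ
  InT v = Σ (Fin n) λ k → (toℕ k ≡ v) × (k ∈ T)

  InT? : Decidable InT
  InT? v = any? λ k → (toℕ k ≟ v) ×-dec (k ∈? T)

  InT-bounded : ∀ {v} → InT v → v < n
  InT-bounded (k , refl , _) = toℕ<n k

  open Construction InT? n InT-bounded
  open ListPermutation word word-bounded word-complete
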